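{- Let $(V,H)$ be a $3$-uniform hypergraph with $n=|V|\ge 2$ vertices ($V$ finite) in which no line is universal, and let $m$ be the number of distinct lines. For $x\in V$ let $\beta(x)=\{\overline{xw}: w\in V,\ w\neq x\}$, and for $S\subseteq V$ define the span of $S$ to be $\bigcup_{x\in S}\beta(x)$. If $S$ is a nonempty set of $s$ vertices whose span consists of $t$ lines, then \[ m-t\ \ge\ \log_2(n-s)-s\log_2 t. \]
   Context: A $3$-uniform hypergraph is a pair $(V,H)$ where $H$ is a family of $3$-element subsets of $V$. For distinct vertices $u,v$, the line $\overline{uv}$ is defined as $\overline{uv}=\{u,v\}\cup\{p\in V:\{u,v,p\}\in H\}$ (lines are counted as sets, so $m$ is the number of distinct sets of this form). A line is universal if it equals $V$. -}

module Defs where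

open import Data.Nat using (ℕ; _≡ᵇ_)
open import Data.Bool using (Bool; true; false; _∨_; not; _∧_) renaming (_≟_ to _≟ᵇ_)
open import Data.Fin using (Fin; _≟_)
open import Data.Fin.Subset using (Subset; ⁅_⁆; _∪_; ∣_∣; ⊤; inside; outside)
open import Data.Fin.Subset.Properties using (_∈?_)
open import Data.List using (List; []; _∷_; length; map; concatMap; filter; deduplicate; allFin)
open import Data.List.Relation.Unary.All using (All)
import Data.List.Membership.DecPropositional as DecMem
open import Data.Vec using (tabulate)
open import Data.Vec.Properties using (≡-dec)
open import Relation.Nullary using (Dec; yes; no; ¬_; ¬?)
open import Relation.Nullary.Decidable using (⌊_⌋)
open import Relation.Binary.PropositionalEquality using (_≡_)

_≟ˢ_ : ∀ {n} → (a b : Subset n) → Dec (a ≡ b)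
_≟ˢ_ = ≡-dec _≟ᵇ_

record Hypergraph3 (n : ℕ) : Set where
  field
    edges   : List (Subset n)
    uniform : All (λ e → ∣ e ∣ ≡ 3) edges

open Hypergraph3 public

triple : ∀ {n} → Fin n → Fin n → Fin n → Subset n
triple u v p = ⁅ u ⁆ ∪ (⁅ v ⁆ ∪ ⁅ p ⁆)

inH : ∀ {n} → Hypergraph3 n → Fin n → Fin n → Fin n → Bool
inH {n} H u v p = ⌊ DecMem._∈?_ (_≟ˢ_ {n}) (triple u v p) (edges H) ⌋

line : ∀ {n} → Hypergraph3 n → Fin n → Fin n → Subset n
line H u v = tabulate λ p → ⌊ p ≟ u ⌋ ∨ (⌊ p ≟ v ⌋ ∨ inH H u v p)

others : ∀ {n} → Fin n → List (Fin n)
others {n} x = filter (λ w → ¬? (w ≟ x)) (allFin n)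

βlist : ∀ {n} → Hypergraph3 n → Fin n → List (Subset n)
βlist H x = map (line H x) (others x)

allLines : ∀ {n} → Hypergraph3 n → List (Subset n)
allLines {n} H = concatMap (βlist H) (allFin n)

numLines : ∀ {n} → Hypergraph3 n → ℕ
numLines H = length (deduplicate _≟ˢ_ (allLines H))

members : ∀ {n} → Subset n → List (Fin n)
members {n} S = filter (λ x → x ∈? S) (allFin n)

spanList : ∀ {n} → Hypergraph3 n → Subset n → List (Subset n)
spanList H S = concatMap (βlist H) (members S)

spanSize : ∀ {n} → Hypergraph3 n → Subset n → ℕ
spanSize H S = length (deduplicate _≟ˢ_ (spanList H S))

NoUniversalLine : ∀ {n} → Hypergraph3 n → Set
NoUniversalLine H = ∀ u v → ¬ (u ≡ v) → ¬ (line H u v ≡ ⊤)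

-- Encode each vertex v outside S by the lines xv (x ∈ S), which lie in the span, together with
-- the set of lines outside the span that pass through v. There are at most t^s * 2^(m-t) such
-- codes, and the encoding is injective: if v ≠ v' had the same code, every line vp would pass
-- through v' (a line off the span because it passes through v, a line xw of the span because
-- xv = xv' forces v' onto every line xw through v), so the line vv' would be universal.
module Submission where

open import Defs
open import Level using (Level)
open import Data.Bool using (Bool; true; false; T; _∨_)
open import Data.Bool.Properties using (T-≡)
open import Data.Nat using (ℕ; zero; suc; _≤_; _+_; _*_; _^_; _∸_; z≤n; s≤s)
open import Data.Nat.Properties
  using (+-suc; *-comm; *-monoʳ-≤; ^-monoʳ-≤; m+n∸n≡m; ∸-monoˡ-≤; module ≤-Reasoning)
open import Data.Fin using (Fin; _≟_) renaming (zero to fzero; suc to fsuc)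
open import Data.Fin.Subset using (Subset; ∣_∣; Nonempty; ⁅_⁆; _∪_; ⊤; ∁; inside; outside)
  renaming (_∈_ to _∈ₛ_; _∉_ to _∉ₛ_)
open import Data.Fin.Subset.Properties
  using (_∈?_; ∪-comm; ⊆⊤; ⊆-antisym; x∈∁p⇒x∉p; ∣∁p∣≡n∸∣p∣)
open import Data.Vec using (lookup) renaming (_∷_ to _∷ᵛ_; [] to []ᵛ)
open import Data.Vec.Properties using (lookup∘tabulate; lookup⇒[]=; []=⇒lookup)
open import Data.List
  using ( List; []; _∷_; [_]; length; tabulate; map; _++_; filter; deduplicate; allFin
        ; cartesianProductWith; cartesianProduct)
open import Data.List.Properties
  using (length-++; length-map; map-tabulate; ∷-injectiveˡ; ∷-injectiveʳ)
open import Data.List.Membership.Propositional using (_∈_; find; lose)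
open import Data.List.Membership.Propositional.Properties
  using (∈-∃++; ∈-++⁺ˡ; ∈-++⁺ʳ; ∈-++⁻; ∈-map⁺; ∈-map⁻; ∈-filter⁺; ∈-filter⁻; ∈-allFin;
         ∈-concatMap⁺; ∈-concatMap⁻; ∈-deduplicate⁺; ∈-deduplicate⁻; ∈-cartesianProductWith⁺;
         ∈-cartesianProduct⁺)
open import Data.List.Relation.Unary.Any using (here; there)
import Data.List.Relation.Unary.All as All
open import Data.List.Relation.Unary.AllPairs using (_∷_)
open import Data.List.Relation.Unary.Unique.Propositional using (Unique)
import Data.List.Relation.Unary.Unique.Propositional.Properties as Unique
open import Data.List.Relation.Unary.Unique.DecPropositional.Properties using (deduplicate-!)
import Data.List.Membership.DecPropositional as DecMembership
open import Data.Product using (_×_; _,_; ∃₂; proj₁; proj₂)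
open import Data.Sum using (_⊎_; inj₁; inj₂)
open import Data.Empty using (⊥-elim)
open import Function using (_∘_; id; const; _⇔_; mk⇔; Equivalence)
open import Data.Unit using (tt)
open import Relation.Binary.PropositionalEquality
  using (_≡_; _≢_; refl; sym; trans; cong; cong₂; subst; module ≡-Reasoning)
open import Relation.Nullary using (yes; no; ¬?; does)
open import Relation.Nullary.Decidable using (⌊_⌋)

private
  variable
    a b c : Level
    A : Set a
    B : Set b
    C : Set c

injectiveOn⇒length-≤ : (f : A → B) {xs : List A} {ys : List B} → Unique xs →
                       (∀ {x y} → x ∈ xs → y ∈ xs → f x ≡ f y → x ≡ y) →
                       (∀ {x} → x ∈ xs → f x ∈ ys) →
                       length xs ≤ length ys
injectiveOn⇒length-≤ f {[]} _ _ _ = z≤n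
injectiveOn⇒length-≤ f {x ∷ xs} (x∉xs ∷ xs!) inj f∈ with ∈-∃++ (f∈ (here refl))
... | ys , zs , refl = begin
  suc (length xs)               ≤⟨ s≤s (injectiveOn⇒length-≤ f xs! (λ p q → inj (there p) (there q)) f∈ys++zs) ⟩
  suc (length (ys ++ zs))       ≡⟨ cong suc (length-++ ys) ⟩
  suc (length ys + length zs)   ≡⟨ +-suc (length ys) (length zs) ⟨
  length ys + length (f x ∷ zs) ≡⟨ length-++ ys ⟨
  length (ys ++ f x ∷ zs)       ∎
  where
  open ≤-Reasoning
  f∈ys++zs : ∀ {y} → y ∈ xs → f y ∈ ys ++ zs
  f∈ys++zs {y} y∈xs with ∈-++⁻ ys (f∈ (there y∈xs))
  ... | inj₁ fy∈ys         = ∈-++⁺ˡ fy∈ys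
  ... | inj₂ (here fy≡fx)  =
    ⊥-elim (All.lookup x∉xs y∈xs (sym (inj (there y∈xs) (here refl) fy≡fx)))
  ... | inj₂ (there fy∈zs) = ∈-++⁺ʳ ys fy∈zs

length-cartesianProductWith : (f : A → B → C) (xs : List A) (ys : List B) →
                              length (cartesianProductWith f xs ys) ≡ length xs * length ys
length-cartesianProductWith f []       ys = refl
length-cartesianProductWith f (x ∷ xs) ys = begin
  length (map (f x) ys ++ cartesianProductWith f xs ys)
    ≡⟨ length-++ (map (f x) ys) ⟩
  length (map (f x) ys) + length (cartesianProductWith f xs ys)
    ≡⟨ cong₂ _+_ (length-map (f x) ys) (length-cartesianProductWith f xs ys) ⟩
  length ys + length xs * length ys ∎
  where open ≡-Reasoning

tuples : List A → ℕ → List (List A)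
tuples xs zero    = [ [] ]
tuples xs (suc k) = cartesianProductWith _∷_ xs (tuples xs k)

length-tuples : (xs : List A) (k : ℕ) → length (tuples xs k) ≡ length xs ^ k
length-tuples xs zero    = refl
length-tuples xs (suc k) =
  trans (length-cartesianProductWith _∷_ xs (tuples xs k)) (cong (length xs *_) (length-tuples xs k))

map-∈-tuples : (g : B → A) {xs : List A} (zs : List B) →
               (∀ {z} → z ∈ zs → g z ∈ xs) → map g zs ∈ tuples xs (length zs)
map-∈-tuples g []       _  = here refl
map-∈-tuples g (z ∷ zs) g∈ =
  ∈-cartesianProductWith⁺ _∷_ (g∈ (here refl)) (map-∈-tuples g zs (g∈ ∘ there))

map-≡⇒≡ : (f g : A → B) {zs : List A} → map f zs ≡ map g zs → ∀ {z} → z ∈ zs → f z ≡ g z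
map-≡⇒≡ f g {_ ∷ _} eq (here refl) = ∷-injectiveˡ eq
map-≡⇒≡ f g {_ ∷ _} eq (there z∈) = map-≡⇒≡ f g (∷-injectiveʳ eq) z∈

filter-∈?-map-suc : ∀ {n} (β : Bool) (p : Subset n) (xs : List (Fin n)) →
                    filter (_∈? β ∷ᵛ p) (map fsuc xs) ≡ map fsuc (filter (_∈? p) xs)
filter-∈?-map-suc β p []       = refl
filter-∈?-map-suc β p (x ∷ xs) with does (x ∈? p)
... | true  = cong (fsuc x ∷_) (filter-∈?-map-suc β p xs)
... | false = filter-∈?-map-suc β p xs

length-filter-∈?-tabulate-suc : ∀ {n} (β : Bool) (p : Subset n) →
                                length (filter (_∈? β ∷ᵛ p) (tabulate fsuc)) ≡ length (members p)
length-filter-∈?-tabulate-suc {n} β p = begin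
  length (filter (_∈? β ∷ᵛ p) (tabulate fsuc))
    ≡⟨ cong (length ∘ filter (_∈? β ∷ᵛ p)) (map-tabulate id fsuc) ⟨
  length (filter (_∈? β ∷ᵛ p) (map fsuc (allFin n)))
    ≡⟨ cong length (filter-∈?-map-suc β p (allFin n)) ⟩
  length (map fsuc (members p))
    ≡⟨ length-map fsuc (members p) ⟩
  length (members p) ∎
  where open ≡-Reasoning

length-members : ∀ {n} (p : Subset n) → length (members p) ≡ ∣ p ∣
length-members []ᵛ            = refl
length-members (inside ∷ᵛ p)  =
  cong suc (trans (length-filter-∈?-tabulate-suc inside p) (length-members p))
length-members (outside ∷ᵛ p) = trans (length-filter-∈?-tabulate-suc outside p) (length-members p)

∈-members⁺ : ∀ {n} {p : Subset n} {x} → x ∈ₛ p → x ∈ members p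
∈-members⁺ {n} {p} {x} x∈p = ∈-filter⁺ (_∈? p) (∈-allFin x) x∈p

∈-members⁻ : ∀ {n} {p : Subset n} {x} → x ∈ members p → x ∈ₛ p
∈-members⁻ {n} {p} x∈ = proj₂ (∈-filter⁻ (_∈? p) {xs = allFin n} x∈)

∈-others⁺ : ∀ {n} {x w : Fin n} → w ≢ x → w ∈ others x
∈-others⁺ {n} {x} {w} w≢x = ∈-filter⁺ (λ w → ¬? (w ≟ x)) (∈-allFin w) w≢x

∈-others⁻ : ∀ {n} {x w : Fin n} → w ∈ others x → w ≢ x
∈-others⁻ {n} {x} w∈ = proj₂ (∈-filter⁻ (λ w → ¬? (w ≟ x)) {xs = allFin n} w∈)

module _ {n : ℕ} (H : Hypergraph3 n) where

  Edge : Fin n → Fin n → Fin n → Set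
  Edge u v p = T (inH H u v p)

  edge-swap : ∀ {u v p} → Edge u v p → Edge u p v
  edge-swap {u} {v} {p} =
    subst (λ e → T ⌊ DecMembership._∈?_ _≟ˢ_ e (edges H) ⌋) (cong (⁅ u ⁆ ∪_) (∪-comm ⁅ v ⁆ ⁅ p ⁆))

  T-lookup-line : ∀ u v p → T (lookup (line H u v) p) ⇔ (p ≡ u ⊎ p ≡ v ⊎ Edge u v p)
  T-lookup-line u v p rewrite lookup∘tabulate (λ q → ⌊ q ≟ u ⌋ ∨ (⌊ q ≟ v ⌋ ∨ inH H u v q)) p
    with p ≟ u | p ≟ v
  ... | yes p≡u | _       = mk⇔ (const (inj₁ p≡u)) (const tt)
  ... | no _    | yes p≡v = mk⇔ (const (inj₂ (inj₁ p≡v))) (const tt)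
  ... | no p≢u  | no p≢v  = mk⇔ (inj₂ ∘ inj₂) λ where
    (inj₁ p≡u)        → ⊥-elim (p≢u p≡u)
    (inj₂ (inj₁ p≡v)) → ⊥-elim (p≢v p≡v)
    (inj₂ (inj₂ e))   → e

  ∈-line⁺ : ∀ {u v p} → p ≡ u ⊎ p ≡ v ⊎ Edge u v p → p ∈ₛ line H u v
  ∈-line⁺ {u} {v} {p} h =
    lookup⇒[]= p (line H u v) (Equivalence.to T-≡ (Equivalence.from (T-lookup-line u v p) h))

  ∈-line⁻ : ∀ {u v p} → p ∈ₛ line H u v → p ≢ u → p ≢ v → Edge u v p
  ∈-line⁻ {u} {v} {p} p∈ p≢u p≢v
    with Equivalence.to (T-lookup-line u v p) (Equivalence.from T-≡ ([]=⇒lookup p∈))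
  ... | inj₁ p≡u        = ⊥-elim (p≢u p≡u)
  ... | inj₂ (inj₁ p≡v) = ⊥-elim (p≢v p≡v)
  ... | inj₂ (inj₂ e)   = e

  ∈-line-swap : ∀ {x v w} → v ≢ x → v ∈ₛ line H x w → w ∈ₛ line H x v
  ∈-line-swap {x} {v} {w} v≢x v∈ with w ≟ v
  ... | yes refl = ∈-line⁺ (inj₂ (inj₁ refl))
  ... | no w≢v   = ∈-line⁺ (inj₂ (inj₂ (edge-swap (∈-line⁻ v∈ v≢x (w≢v ∘ sym)))))

  ∈-line-transfer : ∀ {x v v' w} → w ≢ x → v ≢ x → line H x v ≡ line H x v' →
                    v ∈ₛ line H x w → v' ∈ₛ line H x w
  ∈-line-transfer {w = w} w≢x v≢x xv≡xv' v∈ =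
    ∈-line-swap w≢x (subst (w ∈ₛ_) xv≡xv' (∈-line-swap v≢x v∈))

  lines-through⇒universal : ∀ {v v'} → v' ≢ v → (∀ p → p ≢ v → v' ∈ₛ line H v p) →
                            line H v v' ≡ ⊤
  lines-through⇒universal {v} {v'} v'≢v through = ⊆-antisym ⊆⊤ λ {p} _ → on-line p
    where
    on-line : ∀ p → p ∈ₛ line H v v'
    on-line p with p ≟ v
    ... | yes p≡v = ∈-line⁺ (inj₁ p≡v)
    ... | no p≢v  = ∈-line-swap v'≢v (through p p≢v)

  ∈-allLines⁺ : ∀ {u v} → v ≢ u → line H u v ∈ allLines H
  ∈-allLines⁺ {u} v≢u =
    ∈-concatMap⁺ (βlist H) (lose (∈-allFin u) (∈-map⁺ (line H u) (∈-others⁺ v≢u)))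

  ∈-spanList⁺ : ∀ {S x w} → x ∈ₛ S → w ≢ x → line H x w ∈ spanList H S
  ∈-spanList⁺ {x = x} x∈S w≢x =
    ∈-concatMap⁺ (βlist H) (lose (∈-members⁺ x∈S) (∈-map⁺ (line H x) (∈-others⁺ w≢x)))

  ∈-spanList⁻ : ∀ {S L} → L ∈ spanList H S → ∃₂ λ x w → x ∈ₛ S × w ≢ x × L ≡ line H x w
  ∈-spanList⁻ L∈ with find (∈-concatMap⁻ (βlist H) L∈)
  ... | x , x∈ , L∈βx with ∈-map⁻ (line H x) L∈βx
  ... | w , w∈ , L≡xw = x , w , ∈-members⁻ x∈ , ∈-others⁻ w∈ , L≡xw

  module _ (S : Subset n) where

    open DecMembership (_≟ˢ_ {n}) using () renaming (_∈?_ to _∈ˡ?_; _∉_ to _∉ˡ_)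

    distinctLines : List (Subset n)
    distinctLines = deduplicate _≟ˢ_ (allLines H)

    spanLines : List (Subset n)
    spanLines = deduplicate _≟ˢ_ (spanList H S)

    offSpanLines : List (Subset n)
    offSpanLines = filter (λ L → ¬? (L ∈ˡ? spanList H S)) distinctLines

    code : Fin n → List (Subset n) × List Bool
    code v = map (λ x → line H x v) (members S) , map (λ L → lookup L v) offSpanLines

    codes : List (List (Subset n) × List Bool)
    codes = cartesianProduct (tuples spanLines s) (tuples (true ∷ false ∷ []) k)
      where
      s k : ℕ
      s = length (members S)
      k = length offSpanLines

    length-codes : length codes ≡ spanSize H S ^ ∣ S ∣ * 2 ^ length offSpanLines
    length-codes = begin
      length (cartesianProduct (tuples spanLines s) (tuples (true ∷ false ∷ []) k))
        ≡⟨ length-cartesianProductWith _,_ (tuples spanLines s) (tuples (true ∷ false ∷ []) k) ⟩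
      length (tuples spanLines s) * length (tuples (true ∷ false ∷ []) k)
        ≡⟨ cong₂ _*_ (length-tuples spanLines s) (length-tuples (true ∷ false ∷ []) k) ⟩
      spanSize H S ^ s * 2 ^ k
        ≡⟨ cong (λ s → spanSize H S ^ s * 2 ^ k) (length-members S) ⟩
      spanSize H S ^ ∣ S ∣ * 2 ^ k ∎
      where
      open ≡-Reasoning
      s k : ℕ
      s = length (members S)
      k = length offSpanLines

    code-∈-codes : ∀ {v} → v ∉ₛ S → code v ∈ codes
    code-∈-codes {v} v∉S = ∈-cartesianProduct⁺
      (map-∈-tuples (λ x → line H x v) (members S) λ x∈ →
        ∈-deduplicate⁺ _≟ˢ_ (∈-spanList⁺ (∈-members⁻ x∈) λ { refl → v∉S (∈-members⁻ x∈) }))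
      (map-∈-tuples (λ L → lookup L v) offSpanLines λ {L} _ → bool-∈ (lookup L v))
      where
      bool-∈ : ∀ β → β ∈ true ∷ false ∷ []
      bool-∈ true  = here refl
      bool-∈ false = there (here refl)

    same-code⇒∈-line : ∀ {v v' p} → v ∉ₛ S → code v ≡ code v' → p ≢ v → v' ∈ₛ line H v p
    same-code⇒∈-line {v} {v'} {p} v∉S same p≢v with line H v p ∈ˡ? spanList H S
    ... | no off = lookup⇒[]= v' (line H v p) (trans (sym same-bit) ([]=⇒lookup (∈-line⁺ (inj₁ refl))))
      where
      same-bit : lookup (line H v p) v ≡ lookup (line H v p) v'
      same-bit = map-≡⇒≡ _ _ (cong proj₂ same)
        (∈-filter⁺ (λ L → ¬? (L ∈ˡ? spanList H S)) (∈-deduplicate⁺ _≟ˢ_ (∈-allLines⁺ p≢v)) off)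
    ... | yes on with ∈-spanList⁻ on
    ... | x , w , x∈S , w≢x , vp≡xw = subst (v' ∈ₛ_) (sym vp≡xw)
      (∈-line-transfer w≢x (λ { refl → v∉S x∈S })
        (map-≡⇒≡ _ _ (cong proj₁ same) (∈-members⁺ x∈S))
        (subst (v ∈ₛ_) vp≡xw (∈-line⁺ (inj₁ refl))))

    code-injective : NoUniversalLine H → ∀ {v v'} → v ∉ₛ S → code v ≡ code v' → v ≡ v'
    code-injective noUniversal {v} {v'} v∉S same with v ≟ v'
    ... | yes v≡v' = v≡v'
    ... | no v≢v'  = ⊥-elim (noUniversal v v' v≢v'
      (lines-through⇒universal (v≢v' ∘ sym) λ _ → same-code⇒∈-line v∉S same))

    length-offSpanLines+spanLines : length offSpanLines + length spanLines ≤ numLines H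
    length-offSpanLines+spanLines = begin
      length offSpanLines + length spanLines ≡⟨ length-++ offSpanLines ⟨
      length (offSpanLines ++ spanLines)     ≤⟨ injectiveOn⇒length-≤ id unique (λ _ _ → id) ⊆distinct ⟩
      length distinctLines                   ∎
      where
      open ≤-Reasoning
      ∈-offSpanLines⁻ : ∀ {L} → L ∈ offSpanLines → L ∈ distinctLines × L ∉ˡ spanList H S
      ∈-offSpanLines⁻ = ∈-filter⁻ (λ L → ¬? (L ∈ˡ? spanList H S)) {xs = distinctLines}
      unique : Unique (offSpanLines ++ spanLines)
      unique = Unique.++⁺ (Unique.filter⁺ _ (deduplicate-! _≟ˢ_ (allLines H)))
                          (deduplicate-! _≟ˢ_ (spanList H S))
                          λ (L∈off , L∈span) → proj₂ (∈-offSpanLines⁻ L∈off)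
                                                 (∈-deduplicate⁻ _≟ˢ_ (spanList H S) L∈span)
      ⊆distinct : ∀ {L} → L ∈ offSpanLines ++ spanLines → L ∈ distinctLines
      ⊆distinct L∈ with ∈-++⁻ offSpanLines L∈
      ... | inj₁ L∈off  = proj₁ (∈-offSpanLines⁻ L∈off)
      ... | inj₂ L∈span with ∈-spanList⁻ (∈-deduplicate⁻ _≟ˢ_ (spanList H S) L∈span)
      ... | _ , _ , _ , w≢x , refl = ∈-deduplicate⁺ _≟ˢ_ (∈-allLines⁺ w≢x)

    length-offSpanLines : length offSpanLines ≤ numLines H ∸ spanSize H S
    length-offSpanLines = begin
      length offSpanLines                                       ≡⟨ m+n∸n≡m (length offSpanLines) (length spanLines) ⟨
      length offSpanLines + length spanLines ∸ length spanLines ≤⟨ ∸-monoˡ-≤ (length spanLines) length-offSpanLines+spanLines ⟩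
      numLines H ∸ spanSize H S                                 ∎
      where open ≤-Reasoning

-- The hypotheses 2 ≤ n and Nonempty S only make the logarithms of the original inequality defined.
lemma3 : (n : ℕ) → 2 ≤ n → (H : Hypergraph3 n) → NoUniversalLine H →
         (S : Subset n) → Nonempty S →
         n ∸ ∣ S ∣ ≤ 2 ^ (numLines H ∸ spanSize H S) * spanSize H S ^ ∣ S ∣
lemma3 n _ H noUniversal S _ = begin
  n ∸ ∣ S ∣                         ≡⟨ ∣∁p∣≡n∸∣p∣ S ⟨
  ∣ ∁ S ∣                            ≡⟨ length-members (∁ S) ⟨
  length (members (∁ S))             ≤⟨ injectiveOn⇒length-≤ (code H S) (Unique.filter⁺ _ (Unique.allFin⁺ n))
                                         (λ v∈ _ → code-injective H S noUniversal (∉S v∈))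
                                         (code-∈-codes H S ∘ ∉S) ⟩
  length (codes H S)                 ≡⟨ length-codes H S ⟩
  t ^ ∣ S ∣ * 2 ^ length (offSpanLines H S)
                                     ≤⟨ *-monoʳ-≤ (t ^ ∣ S ∣) (^-monoʳ-≤ 2 (length-offSpanLines H S)) ⟩
  t ^ ∣ S ∣ * 2 ^ (numLines H ∸ t)  ≡⟨ *-comm (t ^ ∣ S ∣) _ ⟩
  2 ^ (numLines H ∸ t) * t ^ ∣ S ∣  ∎
  where
  open ≤-Reasoning
  t : ℕ
  t = spanSize H S
  ∉S : ∀ {v} → v ∈ members (∁ S) → v ∉ₛ S
  ∉S = x∈∁p⇒x∉p ∘ ∈-members⁻
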